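{- Let $I$ and $J$ be independent sets in a claw-free graph $G$ such that $I$ is not a dominating set of $G$ and every connected component of $G[I\Delta J]$ is a cycle. Then $I\leftrightarrow_{\mathrm{TJ}} J$.
   Context: Graphs are finite and simple; claw-free means no induced $K_{1,3}$. $S$ is dominating if $N[v]\cap S\neq\emptyset$ for all $v$. A TJ-sequence is a sequence $I_0,\ldots,I_m$ of independent sets of equal size such that for each $i$ there are vertices $u,v$ with $I_i\setminus I_{i+1}=\{u\}$, $I_{i+1}\setminus I_i=\{v\}$; $I\leftrightarrow_{\mathrm{TJ}} J$ means a TJ-sequence from $I$ to $J$ exists. -}

module Defs where

open import Data.Nat using (ℕ; zero; suc; _%_; _≤_)
open import Data.Bool using (Bool; true; false)
open import Data.Fin using (Fin; toℕ)
open import Data.Fin.Subset using (Subset; _∈_; _∉_; _∪_; _─_)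
open import Data.Product using (Σ; ∃; _×_; _,_)
open import Data.Sum using (_⊎_)
open import Data.Empty using (⊥)
open import Relation.Nullary using (¬_)
open import Relation.Binary.PropositionalEquality using (_≡_; _≢_)
open import Function using (_⇔_)
open import Function.Definitions using (Injective)

record Graph (n : ℕ) : Set where
  field
    adj    : Fin n → Fin n → Bool
    sym    : ∀ u v → adj u v ≡ adj v u
    irrefl : ∀ v → adj v v ≡ false

  Adj : Fin n → Fin n → Set
  Adj u v = adj u v ≡ true

open Graph public

module _ {n : ℕ} (G : Graph n) where

  IsClaw : Fin n → Fin n → Fin n → Fin n → Set
  IsClaw c a b d =
    Adj G c a × Adj G c b × Adj G c d ×
    a ≢ b × a ≢ d × b ≢ d ×
    ¬ Adj G a b × ¬ Adj G a d × ¬ Adj G b d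

  ClawFree : Set
  ClawFree = ∀ c a b d → ¬ IsClaw c a b d

  Independent : Subset n → Set
  Independent I = ∀ u v → u ∈ I → v ∈ I → ¬ Adj G u v

  Dominating : Subset n → Set
  Dominating S = ∀ v → ∃ λ u → u ∈ S × (u ≡ v ⊎ Adj G v u)

  data Reach (S : Subset n) (u : Fin n) : Fin n → Set where
    here : u ∈ S → Reach S u u
    next : ∀ {v w} → Reach S u v → w ∈ S → Adj G v w → Reach S u w

  -- every connected component of G[S] is a cycle: for every vertex u of S there
  -- is an injective cyclic enumeration c : Fin k → Fin n (k ≥ 3) whose image is
  -- exactly the component of u in G[S], and two vertices of the component are
  -- adjacent iff they are cyclically consecutive in the enumeration.
  -- i, j cyclically consecutive in Z/k (indices of Fin k)
  CycNext : (k : ℕ) → Fin k → Fin k → Set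
  CycNext zero ()
  CycNext (suc m) i j = toℕ j ≡ suc (toℕ i) % suc m ⊎ toℕ i ≡ suc (toℕ j) % suc m

  EveryComponentCycle : Subset n → Set
  EveryComponentCycle S =
    ∀ u → u ∈ S →
      Σ ℕ λ k → 3 ≤ k × Σ (Fin k → Fin n) λ c →
        Injective _≡_ _≡_ c ×
        (∀ v → Reach S u v ⇔ (∃ λ i → c i ≡ v)) ×
        (∀ i j → Adj G (c i) (c j) ⇔ CycNext k i j)

  _Δ_ : Subset n → Subset n → Subset n
  I Δ J = (I ─ J) ∪ (J ─ I)

  TJStep : Subset n → Subset n → Set
  TJStep I I' = ∃ λ u → ∃ λ v →
    u ∈ I × u ∉ I' × v ∈ I' × v ∉ I ×
    (∀ w → w ≢ u → w ≢ v → (w ∈ I ⇔ w ∈ I'))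

  data _↔TJ_ : Subset n → Subset n → Set where
    done : ∀ {I} → Independent I → I ↔TJ I
    step : ∀ {I K J} → Independent I → TJStep I K → K ↔TJ J → I ↔TJ J

module Submission where

-- Let w be a vertex not dominated by I. Every vertex of I Δ J lies on a cycle of
-- G[I Δ J], hence has two neighbours on the other side, while by claw-freeness no vertex
-- has three neighbours in an independent set; counting the edges between I ∖ J and J ∖ I
-- from both ends gives |I ∖ J| = |J ∖ I|. Claw-freeness also shows that w ∉ J and that
-- w has no neighbour in J: such a neighbour x ∈ J ∖ I would be the centre of a claw with
-- w and the two cycle neighbours of x, which lie in I.
--
-- So a token of I ∖ J can jump to w, giving K. While K ∖ J contains vertices other than
-- w, the same double counting, now with w adjacent to nothing in J ∖ K, yields b ∈ J ∖ K
-- with at most one neighbour in (K ∖ J) - w; a token of (K ∖ J) - w, namely that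
-- neighbour if it exists, jumps to b and K stays independent. The token on w jumps last.

open import Data.Nat.Properties
  using (+-*-semiring; +-suc; +-mono-≤; *-zeroʳ; *-identityʳ; *-cancelˡ-≤; ≤-trans;
         ≤-antisym; ≰⇒>; 1+n≰n; suc-injective; m≤n⇒m<n∨m≡n; m≢1+n+m; module ≤-Reasoning)
open import Algebra.Properties.Semiring.Sum +-*-semiring
  using (sum; sum-syntax; ∑-comm; sum-cong-≗; sum-replicate-zero; *-distribˡ-sum)
open import Data.Bool using (Bool; true; false; _∧_; _∨_; not; if_then_else_)
open import Data.Bool.Properties using (∧-conicalˡ; ∧-conicalʳ) renaming (_≟_ to _≟ᵇ_)
open import Data.Empty using (⊥-elim)
open import Data.Fin using (Fin; zero; suc; toℕ; fromℕ; fromℕ<; inject₁; _≟_)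
open import Data.Fin.Properties
  using (any?; ¬∀⟶∃¬; toℕ-fromℕ<; toℕ-fromℕ; toℕ-inject₁; toℕ<n)
open import Data.Fin.Subset using (Subset; _∈_; _∉_; _⊆_; _─_; inside; outside)
open import Data.Fin.Subset.Properties
  using (_∈?_; x∈p∪q⁻; x∈p∪q⁺; p─q⊆p; x∈p∧x∉q⇒x∈p─q; ⊆-antisym)
open import Data.Nat using (ℕ; zero; suc; _+_; _*_; _≤_; _<_; _%_; z≤n; s≤s; s≤s⁻¹; _≤?_)
open import Data.Nat.DivMod using (m%n<n; m<n⇒m%n≡m; n%n≡0)
open import Data.Product using (∃; ∃₂; _×_; _,_; proj₁; proj₂; uncurry)
open import Data.Sum using (_⊎_; inj₁; inj₂; swap; map)
open import Data.Vec using (_∷_; here; there; lookup; tabulate)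
open import Data.Vec.Properties using ([]=⇒lookup; lookup⇒[]=; lookup∘tabulate)
open import Defs renaming (sym to adj-sym)
open import Function using (_∘_; Equivalence; mk⇔)
open import Relation.Binary.PropositionalEquality
open import Relation.Nullary using (¬_; does; yes; no; contradiction)
open import Relation.Nullary.Decidable using (dec-true; dec-false; _×-dec_; _⊎-dec_)

ind : Bool → ℕ
ind false = 0
ind true  = 1

count : ∀ {n} → (Fin n → Bool) → ℕ
count {n} P = ∑[ x < n ] ind (P x)

∑-mono-≤ : ∀ {n} {f g : Fin n → ℕ} → (∀ i → f i ≤ g i) → sum f ≤ sum g
∑-mono-≤ {zero}  _   = z≤n
∑-mono-≤ {suc n} f≤g = +-mono-≤ (f≤g zero) (∑-mono-≤ (f≤g ∘ suc))

count-cong : ∀ {n} {P Q : Fin n → Bool} → (∀ x → P x ≡ Q x) → count P ≡ count Q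
count-cong P≗Q = sum-cong-≗ (cong ind ∘ P≗Q)

-- The set operations are opaque so that their arguments can be inferred by unification.
opaque
  _-_ : ∀ {n} → (Fin n → Bool) → Fin n → Fin n → Bool
  (P - a) x = if does (x ≟ a) then false else P x

  remove-self : ∀ {n} {P : Fin n → Bool} a → (P - a) a ≡ false
  remove-self a rewrite dec-true (a ≟ a) refl = refl

  remove-other : ∀ {n} {P : Fin n → Bool} {a x} → x ≢ a → (P - a) x ≡ P x
  remove-other {a = a} {x} x≢a rewrite dec-false (x ≟ a) x≢a = refl

  remove⁻ : ∀ {n} {P : Fin n → Bool} {a x} → (P - a) x ≡ true → x ≢ a × P x ≡ true
  remove⁻ {a = a} {x} e with x ≟ a
  ... | no x≢a = x≢a , e

  count-remove : ∀ {n} (P : Fin n → Bool) {a} → P a ≡ true → count P ≡ suc (count (P - a))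
  count-remove {suc n} P {zero}  Pa rewrite Pa = refl
  count-remove {suc n} P {suc a} Pa =
    trans (cong (ind (P zero) +_) (count-remove (P ∘ suc) Pa)) (+-suc _ _)

  count-remove-absent : ∀ {n} (P : Fin n → Bool) {a} → P a ≡ false → count (P - a) ≡ count P
  count-remove-absent P {a} Pa = count-cong absent
    where
    absent : ∀ x → (P - a) x ≡ P x
    absent x with x ≟ a
    ... | yes refl = sym Pa
    ... | no _     = refl

count-witness : ∀ {n} {P : Fin n → Bool} → 0 < count P → ∃ λ x → P x ≡ true
count-witness {suc n} {P} pos with P zero in P0
... | true  = zero , P0
... | false with count-witness {P = P ∘ suc} pos
...   | x , Px = suc x , Px

count-pick : ∀ {n} {P : Fin n → Bool} {k} → suc k ≤ count P →
             ∃ λ x → P x ≡ true × k ≤ count (P - x)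
count-pick {P = P} {k} k<count with count-witness (≤-trans (s≤s z≤n) k<count)
... | x , Px = x , Px , s≤s⁻¹ (subst (suc k ≤_) (count-remove P Px) k<count)

count≡0⇒false : ∀ {n} {P : Fin n → Bool} → count P ≡ 0 → ∀ x → P x ≡ false
count≡0⇒false {P = P} c x with P x in Px
... | false = refl
... | true with () ← trans (sym c) (count-remove P Px)

2≤count : ∀ {n} {P : Fin n → Bool} {x y} → P x ≡ true → P y ≡ true → x ≢ y → 2 ≤ count P
2≤count {P = P} {x} {y} Px Py x≢y = begin
  2                               ≤⟨ s≤s (s≤s z≤n) ⟩
  suc (suc (count ((P - x) - y))) ≡⟨ cong suc (count-remove (P - x) P₋x[y]) ⟨
  suc (count (P - x))             ≡⟨ count-remove P Px ⟨
  count P                         ∎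
  where
  open ≤-Reasoning
  P₋x[y] : (P - x) y ≡ true
  P₋x[y] = trans (remove-other (x≢y ∘ sym)) Py

count≥3⇒distinct : ∀ {n} {P : Fin n → Bool} → 3 ≤ count P →
  ∃₂ λ x y → ∃ λ z → x ≢ y × x ≢ z × y ≢ z × P x ≡ true × P y ≡ true × P z ≡ true
count≥3⇒distinct 3≤ with count-pick 3≤
... | x , Px , 2≤ with count-pick 2≤
... | y , P₋y , 1≤ with count-pick 1≤
... | z , P₋₋z , _ with remove⁻ P₋y | remove⁻ P₋₋z
... | y≢x , Py | z≢y , P₋z with remove⁻ P₋z
... | z≢x , Pz = x , y , z , y≢x ∘ sym , z≢x ∘ sym , z≢y ∘ sym , Px , Py , Pz

count≤1⇒⊆-singleton : ∀ {n} {N P : Fin n → Bool} → (∀ x → N x ≡ true → P x ≡ true) →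
  count N ≤ 1 → 0 < count P → ∃ λ a → P a ≡ true × (∀ x → N x ≡ true → x ≡ a)
count≤1⇒⊆-singleton {N = N} N⊆P N≤1 P>0 with count N in cN
... | zero with a , Pa ← count-witness P>0 =
  a , Pa , λ x Nx → contradiction (trans (sym (count≡0⇒false cN x)) Nx) λ ()
... | suc _ with a , Na ← count-witness {P = N} (subst (0 <_) (sym cN) (s≤s z≤n)) =
  a , N⊆P a Na , only-a
  where
  only-a : ∀ x → N x ≡ true → x ≡ a
  only-a x Nx with x ≟ a
  ... | yes x≡a = x≡a
  ... | no  x≢a = ⊥-elim (1+n≰n (≤-trans (subst (2 ≤_) cN (2≤count Nx Na x≢a)) N≤1))

-- Subsets as boolean predicates, and token jumps

x∈p─q⇒x∉q : ∀ {n} {x : Fin n} (p q : Subset n) → x ∈ p ─ q → x ∉ q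
x∈p─q⇒x∉q (inside ∷ p) (outside ∷ q) here ()
x∈p─q⇒x∉q (_ ∷ p) (_ ∷ q) (there x∈) (there x∈q) = x∈p─q⇒x∉q p q x∈ x∈q

x∈p─q⁻ : ∀ {n} {x : Fin n} (p q : Subset n) → x ∈ p ─ q → x ∈ p × x ∉ q
x∈p─q⁻ p q x∈ = p─q⊆p p q x∈ , x∈p─q⇒x∉q p q x∈

module _ {n : ℕ} where

  lookup⇒∈ : ∀ {x} {K : Subset n} → lookup K x ≡ true → x ∈ K
  lookup⇒∈ {x} {K} = lookup⇒[]= x K

  ∉⇒lookup≡false : ∀ {x} {K : Subset n} → x ∉ K → lookup K x ≡ false
  ∉⇒lookup≡false {x} {K} x∉K with lookup K x in Kx
  ... | true  = contradiction (lookup⇒∈ Kx) x∉K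
  ... | false = refl

  lookup≡false⇒∉ : ∀ {x} {K : Subset n} → lookup K x ≡ false → x ∉ K
  lookup≡false⇒∉ Kx x∈K = contradiction (trans (sym Kx) ([]=⇒lookup x∈K)) λ ()

  opaque
    _∖_ : Subset n → Subset n → Fin n → Bool
    (K ∖ J) x = lookup K x ∧ not (lookup J x)

    ∖⁺ : ∀ {x} {K J : Subset n} → x ∈ K → x ∉ J → (K ∖ J) x ≡ true
    ∖⁺ x∈K x∉J rewrite []=⇒lookup x∈K | ∉⇒lookup≡false x∉J = refl

    ∖⁻ : ∀ {x} {K J : Subset n} → (K ∖ J) x ≡ true → x ∈ K × x ∉ J
    ∖⁻ {x} {K} {J} e with lookup K x in Kx | lookup J x in Jx
    ... | true | false = lookup⇒∈ Kx , lookup≡false⇒∉ Jx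

    ∖-outˡ : ∀ {x} {K J : Subset n} → x ∉ K → (K ∖ J) x ≡ false
    ∖-outˡ x∉K rewrite ∉⇒lookup≡false x∉K = refl

    ∖-outʳ : ∀ {x} {K J : Subset n} → x ∈ J → (K ∖ J) x ≡ false
    ∖-outʳ {x} {K} x∈J with lookup K x
    ... | false = refl
    ... | true rewrite []=⇒lookup x∈J = refl

    ∖-cong : ∀ {x} {K K′ J J′ : Subset n} →
             lookup K x ≡ lookup K′ x → lookup J x ≡ lookup J′ x → (K ∖ J) x ≡ (K′ ∖ J′) x
    ∖-cong = cong₂ λ p q → p ∧ not q

  count∖≡0⇒⊆ : ∀ {K J : Subset n} → count (K ∖ J) ≡ 0 → K ⊆ J
  count∖≡0⇒⊆ {J = J} c {x} x∈K with x ∈? J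
  ... | yes x∈J = x∈J
  ... | no  x∉J = contradiction (trans (sym (count≡0⇒false c x)) (∖⁺ x∈K x∉J)) λ ()

  count∖≡0⇒≡ : ∀ {K J : Subset n} → count (K ∖ J) ≡ 0 → count (J ∖ K) ≡ 0 → K ≡ J
  count∖≡0⇒≡ cKJ cJK = ⊆-antisym (count∖≡0⇒⊆ cKJ) (count∖≡0⇒⊆ cJK)

  opaque
    jump : Subset n → Fin n → Fin n → Subset n
    jump K a b = tabulate λ x → does (x ≟ b) ∨ (lookup K - a) x

    lookup-jump : ∀ {K a b} x → lookup (jump K a b) x ≡ does (x ≟ b) ∨ (lookup K - a) x
    lookup-jump = lookup∘tabulate _

  module _ {K : Subset n} {a b : Fin n} where

    b∈jump : b ∈ jump K a b
    b∈jump = lookup⇒∈ (trans (lookup-jump b) (cong (_∨ (lookup K - a) b) (dec-true (b ≟ b) refl)))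

    a∉jump : a ≢ b → a ∉ jump K a b
    a∉jump a≢b = lookup≡false⇒∉ (trans (lookup-jump a)
      (cong₂ _∨_ (dec-false (a ≟ b) a≢b) (remove-self a)))

    lookup-jump-other : ∀ {x} → x ≢ a → x ≢ b → lookup (jump K a b) x ≡ lookup K x
    lookup-jump-other {x} x≢a x≢b = trans (lookup-jump x)
      (cong₂ _∨_ (dec-false (x ≟ b) x≢b) (remove-other x≢a))

    ∈jump⁻ : ∀ {x} → x ∈ jump K a b → x ≡ b ⊎ (x ≢ a × x ∈ K)
    ∈jump⁻ {x} x∈ with x ≟ b | trans (sym (lookup-jump x)) ([]=⇒lookup x∈)
    ... | yes x≡b | _ = inj₁ x≡b
    ... | no  _   | e with remove⁻ e
    ...   | x≢a , Kx = inj₂ (x≢a , lookup⇒∈ Kx)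

    ∈jump⁺ : ∀ {x} → x ≢ a → x ∈ K → x ∈ jump K a b
    ∈jump⁺ {x} x≢a x∈K with x ≟ b
    ... | yes refl = b∈jump
    ... | no  x≢b  = lookup⇒∈ (trans (lookup-jump-other x≢a x≢b) ([]=⇒lookup x∈K))

    jump∖≗ : ∀ {J} → a ≢ b → (K ∖ J) b ≡ false →
             ∀ x → ((jump K a b ∖ J) - b) x ≡ ((K ∖ J) - a) x
    jump∖≗ a≢b Kb x with x ≟ b
    ... | yes refl = trans (remove-self b) (sym (trans (remove-other (a≢b ∘ sym)) Kb))
    ... | no x≢b with x ≟ a
    ...   | yes refl =
      trans (trans (remove-other x≢b) (∖-outˡ (a∉jump a≢b))) (sym (remove-self a))
    ...   | no  x≢a  = trans (remove-other x≢b)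
      (trans (∖-cong (lookup-jump-other x≢a x≢b) refl) (sym (remove-other x≢a)))

    ∖jump≗ : ∀ {J} → a ∉ J → ∀ x → (J ∖ jump K a b) x ≡ ((J ∖ K) - b) x
    ∖jump≗ a∉J x with x ≟ b
    ... | yes refl = trans (∖-outʳ b∈jump) (sym (remove-self b))
    ... | no x≢b with x ≟ a
    ...   | yes refl = trans (∖-outˡ a∉J) (sym (trans (remove-other x≢b) (∖-outˡ a∉J)))
    ...   | no  x≢a  = trans (∖-cong refl (lookup-jump-other x≢a x≢b)) (sym (remove-other x≢b))

    count-jump-across : ∀ {J m m′} → (K ∖ J) a ≡ true → (J ∖ K) b ≡ true →
      count (K ∖ J) ≡ suc m → count (J ∖ K) ≡ suc m′ →
      count (jump K a b ∖ J) ≡ m × count (J ∖ jump K a b) ≡ m′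
    count-jump-across {J} {m} Ka Jb cKJ cJK = (begin
        count (jump K a b ∖ J)       ≡⟨ count-remove-absent (jump K a b ∖ J) (∖-outʳ b∈J) ⟨
        count ((jump K a b ∖ J) - b) ≡⟨ count-cong (jump∖≗ a≢b (∖-outʳ b∈J)) ⟩
        count ((K ∖ J) - a)          ≡⟨ suc-injective (trans (sym (count-remove (K ∖ J) Ka)) cKJ) ⟩
        m                            ∎)
      , trans (count-cong (∖jump≗ a∉J)) (suc-injective (trans (sym (count-remove (J ∖ K) Jb)) cJK))
      where
      open ≡-Reasoning
      a∉J : a ∉ J
      a∉J = proj₂ (∖⁻ Ka)
      b∈J : b ∈ J
      b∈J = proj₁ (∖⁻ Jb)
      a≢b : a ≢ b
      a≢b refl = a∉J b∈J

    count-jump-outside : ∀ {J} → (K ∖ J) a ≡ true → b ∉ K → b ∉ J →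
      count (jump K a b ∖ J) ≡ count (K ∖ J) × count (J ∖ jump K a b) ≡ count (J ∖ K)
    count-jump-outside {J} Ka b∉K b∉J = (begin
        count (jump K a b ∖ J)             ≡⟨ count-remove (jump K a b ∖ J) (∖⁺ b∈jump b∉J) ⟩
        suc (count ((jump K a b ∖ J) - b)) ≡⟨ cong suc (count-cong (jump∖≗ a≢b (∖-outˡ b∉K))) ⟩
        suc (count ((K ∖ J) - a))          ≡⟨ count-remove (K ∖ J) Ka ⟨
        count (K ∖ J)                      ∎)
      , trans (count-cong (∖jump≗ (proj₂ (∖⁻ Ka)))) (count-remove-absent (J ∖ K) (∖-outˡ b∉J))
      where
      open ≡-Reasoning
      a≢b : a ≢ b
      a≢b refl = b∉K (proj₁ (∖⁻ Ka))

module _ (m : ℕ) where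

  private
    k : ℕ
    k = 3 + m

    ≡k⇒%k≡0 : ∀ {t} → t ≡ k → t % k ≡ 0
    ≡k⇒%k≡0 refl = n%n≡0 k

  cyclic-step-twice≢ : ∀ i j → i < k → j ≡ suc i % k → i ≢ suc j % k
  cyclic-step-twice≢ i j i<k j≡ i≡ with m≤n⇒m<n∨m≡n i<k
  ... | inj₂ 1+i≡k with trans i≡ (cong (λ t → suc t % k) (trans j≡ (≡k⇒%k≡0 1+i≡k)))
  ...   | refl with () ← 1+i≡k
  cyclic-step-twice≢ i j i<k j≡ i≡ | inj₁ 1+i<k
      with m≤n⇒m<n∨m≡n 1+i<k | trans i≡ (cong (λ t → suc t % k) (trans j≡ (m<n⇒m%n≡m 1+i<k)))
  ... | inj₁ 2+i<k | i≡[2+i]%k = m≢1+n+m i (trans i≡[2+i]%k (m<n⇒m%n≡m 2+i<k))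
  ... | inj₂ 2+i≡k | i≡[2+i]%k with trans i≡[2+i]%k (≡k⇒%k≡0 2+i≡k)
  ...   | refl with () ← 2+i≡k

cycle-next : ∀ {k} (i : Fin (suc k)) → ∃ λ (j : Fin (suc k)) → toℕ j ≡ suc (toℕ i) % suc k
cycle-next {k} i = fromℕ< (m%n<n (suc (toℕ i)) (suc k)) , toℕ-fromℕ< _

cycle-prev : ∀ {k} (i : Fin (suc k)) → ∃ λ (j : Fin (suc k)) → toℕ i ≡ suc (toℕ j) % suc k
cycle-prev {k} zero    = fromℕ k ,
  sym (trans (cong (λ t → suc t % suc k) (toℕ-fromℕ k)) (n%n≡0 (suc k)))
cycle-prev {k} (suc i) = inject₁ i ,
  sym (trans (cong (λ t → suc t % suc k) (toℕ-inject₁ i)) (m<n⇒m%n≡m (toℕ<n (suc i))))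

module _ {n : ℕ} (G : Graph n) where

  Reach⇒∈ : ∀ {S u v} → Reach G S u v → v ∈ S
  Reach⇒∈ (here u∈S)     = u∈S
  Reach⇒∈ (next _ v∈S _) = v∈S

  cycle-neighbours : ∀ {S x} → EveryComponentCycle G S → x ∈ S →
    ∃₂ λ y z → y ≢ z × y ∈ S × z ∈ S × Adj G x y × Adj G x z
  cycle-neighbours {S} {x} cyc x∈S with cyc x x∈S
  ... | suc (suc (suc m)) , s≤s (s≤s (s≤s _)) , c , c-inj , reach , adj⇔
      with Equivalence.to (reach x) (here x∈S)
  ... | i , refl with cycle-next i | cycle-prev i
  ... | j , j≡ | j′ , i≡ =
    c j , c j′ , distinct , on-cycle j , on-cycle j′ ,
    Equivalence.from (adj⇔ i j) (inj₁ j≡) , Equivalence.from (adj⇔ i j′) (inj₂ i≡)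
    where
    on-cycle : ∀ l → c l ∈ S
    on-cycle l = Reach⇒∈ (Equivalence.from (reach (c l)) (l , refl))
    distinct : c j ≢ c j′
    distinct e with c-inj {j} {j′} e
    ... | refl = cyclic-step-twice≢ m (toℕ i) (toℕ j) (toℕ<n i) j≡ i≡

-- Degrees and double counting

  deg : (Fin n → Bool) → Fin n → ℕ
  deg Q x = count (λ y → Q y ∧ adj G x y)

  handshake-≤ : ∀ k (A B : Fin n → Bool) →
    (∀ a → A a ≡ true → deg B a ≤ k) → (∀ b → B b ≡ true → k ≤ deg A b) →
    k * count B ≤ k * count A
  handshake-≤ k A B deg≤k k≤deg = begin
    k * count B                        ≡⟨ *-distribˡ-sum k (ind ∘ B) ⟩
    ∑[ b < n ] (k * ind (B b))         ≤⟨ ∑-mono-≤ from-B ⟩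
    ∑[ b < n ] count (E b)             ≡⟨ ∑-comm (λ b a → ind (E b a)) ⟩
    ∑[ a < n ] count (λ b → E b a)     ≡⟨ sum-cong-≗ (λ a → count-cong (E-swap a)) ⟩
    ∑[ a < n ] count (λ b → A a ∧ (B b ∧ adj G a b)) ≤⟨ ∑-mono-≤ to-A ⟩
    ∑[ a < n ] (k * ind (A a))         ≡⟨ *-distribˡ-sum k (ind ∘ A) ⟨
    k * count A                        ∎
    where
    open ≤-Reasoning
    E : Fin n → Fin n → Bool
    E b a = B b ∧ (A a ∧ adj G b a)
    from-B : ∀ b → k * ind (B b) ≤ count (E b)
    from-B b with B b in Bb
    ... | true  rewrite *-identityʳ k = k≤deg b Bb
    ... | false rewrite *-zeroʳ k     = z≤n
    to-A : ∀ a → count (λ b → A a ∧ (B b ∧ adj G a b)) ≤ k * ind (A a)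
    to-A a with A a in Aa
    ... | true  rewrite *-identityʳ k = deg≤k a Aa
    ... | false rewrite *-zeroʳ k | sum-replicate-zero n = z≤n
    E-swap : ∀ a b → E b a ≡ (A a ∧ (B b ∧ adj G a b))
    E-swap a b with B b | A a
    ... | true  | true  = adj-sym G b a
    ... | true  | false = refl
    ... | false | true  = refl
    ... | false | false = refl

  claw-free⇒deg≤2 : ClawFree G → ∀ {K Q} → Independent G K → (∀ y → Q y ≡ true → y ∈ K) →
                    ∀ x → deg Q x ≤ 2
  claw-free⇒deg≤2 cf {K} {Q} indK Q⊆K x with 3 ≤? deg Q x
  ... | no  3≰ = s≤s⁻¹ (≰⇒> 3≰)
  ... | yes 3≤ with count≥3⇒distinct 3≤
  ... | a , b , d , a≢b , a≢d , b≢d , Na , Nb , Nd =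
    ⊥-elim (cf x a b d (x~ Na , x~ Nb , x~ Nd , a≢b , a≢d , b≢d , ≁ Na Nb , ≁ Na Nd , ≁ Nb Nd))
    where
    x~ : ∀ {y} → Q y ∧ adj G x y ≡ true → Adj G x y
    x~ = ∧-conicalʳ _ _
    ≁ : ∀ {y z} → Q y ∧ adj G x y ≡ true → Q z ∧ adj G x z ≡ true → ¬ Adj G y z
    ≁ {y} {z} Ny Nz = indK y z (Q⊆K y (∧-conicalˡ _ _ Ny)) (Q⊆K z (∧-conicalˡ _ _ Nz))

  claw-free-handshake : ClawFree G → ∀ {K} {A B : Fin n → Bool} → Independent G K →
    (∀ y → B y ≡ true → y ∈ K) → (∀ b → B b ≡ true → 2 ≤ deg A b) → count B ≤ count A
  claw-free-handshake cf indK B⊆K 2≤deg = *-cancelˡ-≤ 2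
    (handshake-≤ 2 _ _ (λ a _ → claw-free⇒deg≤2 cf indK B⊆K a) 2≤deg)

-- Reconfiguration

  jump-step : ∀ {K a b} → a ∈ K → b ∉ K → TJStep G K (jump K a b)
  jump-step {K} {a} {b} a∈K b∉K = a , b , a∈K , a∉jump a≢b , b∈jump , b∉K , λ x x≢a x≢b →
    mk⇔ (∈jump⁺ x≢a) (lookup⇒∈ ∘ trans (sym (lookup-jump-other x≢a x≢b)) ∘ []=⇒lookup)
    where
    a≢b : a ≢ b
    a≢b refl = b∉K a∈K

  jump-independent : ∀ {K a b} → Independent G K → (∀ y → y ∈ K → Adj G b y → y ≡ a) →
                     Independent G (jump K a b)
  jump-independent indK b~⇒a u v u∈ v∈ with ∈jump⁻ u∈ | ∈jump⁻ v∈
  ... | inj₁ refl        | inj₁ refl        = λ u~u → contradiction (trans (sym (irrefl G u)) u~u) λ ()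
  ... | inj₁ refl        | inj₂ (v≢a , v∈K) = v≢a ∘ b~⇒a v v∈K
  ... | inj₂ (u≢a , u∈K) | inj₁ refl        = u≢a ∘ b~⇒a u u∈K ∘ trans (adj-sym G v u)
  ... | inj₂ (_ , u∈K)   | inj₂ (_ , v∈K)   = indK u v u∈K v∈K

  module _ (cf : ClawFree G) {J : Subset n} (indJ : Independent G J)
           {w : Fin n} (w∉J : w ∉ J) (w≁J : ∀ y → y ∈ J → ¬ Adj G w y) where

    count-without-w : ∀ {K k} → w ∈ K → count (K ∖ J) ≡ suc k → count ((K ∖ J) - w) ≡ k
    count-without-w {K} w∈K c = suc-injective (trans (sym (count-remove (K ∖ J) (∖⁺ w∈K w∉J))) c)

    -- Otherwise double counting would give |J ∖ K| ≤ |(K ∖ J) - w| = |J ∖ K| - 1.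
    ∃-low-degree : ∀ {K m} → w ∈ K →
                   count (K ∖ J) ≡ suc (suc m) → count (J ∖ K) ≡ suc (suc m) →
                   ∃ λ b → (J ∖ K) b ≡ true × deg ((K ∖ J) - w) b ≤ 1
    ∃-low-degree {K} w∈K cKJ cJK
      with any? (λ b → ((J ∖ K) b ≟ᵇ true) ×-dec (deg ((K ∖ J) - w) b ≤? 1))
    ... | yes found = found
    ... | no ¬found = ⊥-elim (1+n≰n (subst₂ _≤_ cJK (count-without-w w∈K cKJ)
            (claw-free-handshake cf indJ (λ _ → proj₁ ∘ ∖⁻)
              λ b Jb → ≰⇒> λ deg≤1 → ¬found (b , Jb , deg≤1))))

    ∃-exchange : ∀ {K m} → w ∈ K →
      count (K ∖ J) ≡ suc (suc m) → count (J ∖ K) ≡ suc (suc m) →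
      ∃₂ λ a b → (K ∖ J) a ≡ true × a ≢ w × (J ∖ K) b ≡ true ×
                 (∀ y → y ∈ K → Adj G b y → y ≡ a)
    ∃-exchange {K} w∈K cKJ cJK with ∃-low-degree w∈K cKJ cJK
    ... | b , Jb , deg≤1
        with count≤1⇒⊆-singleton (λ _ → ∧-conicalˡ _ _) deg≤1
               (subst (0 <_) (sym (count-without-w w∈K cKJ)) (s≤s z≤n))
    ... | a , Aa , only-a = a , b , proj₂ (remove⁻ Aa) , proj₁ (remove⁻ Aa) , Jb , λ y y∈K b~y →
            only-a y (cong₂ _∧_ (trans (remove-other (y≢w y b~y)) (∖⁺ y∈K (y∉J y b~y))) b~y)
      where
      b∈J : b ∈ J
      b∈J = proj₁ (∖⁻ Jb)
      y∉J : ∀ y → Adj G b y → y ∉ J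
      y∉J y b~y y∈J = indJ b y b∈J y∈J b~y
      y≢w : ∀ y → Adj G b y → y ≢ w
      y≢w y b~y refl = w≁J b b∈J (trans (adj-sym G y b) b~y)

    free-token⇒↔TJ : ∀ m {K} → Independent G K → w ∈ K →
                     count (K ∖ J) ≡ suc m → count (J ∖ K) ≡ suc m → _↔TJ_ G K J
    free-token⇒↔TJ zero {K} indK w∈K cKJ cJK
      with count-witness {P = J ∖ K} (subst (0 <_) (sym cJK) (s≤s z≤n))
    ... | b , Jb = step indK (jump-step w∈K (proj₂ (∖⁻ Jb)))
                     (subst (λ L → _↔TJ_ G L J) (sym (count∖≡0⇒≡ (proj₁ counts) (proj₂ counts)))
                       (done indJ))
      where
      counts : count (jump K w b ∖ J) ≡ 0 × count (J ∖ jump K w b) ≡ 0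
      counts = count-jump-across (∖⁺ w∈K w∉J) Jb cKJ cJK
    free-token⇒↔TJ (suc m) {K} indK w∈K cKJ cJK with ∃-exchange w∈K cKJ cJK
    ... | a , b , Ka , a≢w , Jb , b~⇒a =
      step indK (jump-step (proj₁ (∖⁻ Ka)) (proj₂ (∖⁻ Jb)))
        (free-token⇒↔TJ m (jump-independent indK b~⇒a) (∈jump⁺ (a≢w ∘ sym) w∈K)
          (proj₁ counts) (proj₂ counts))
      where
      counts : count (jump K a b ∖ J) ≡ suc m × count (J ∖ jump K a b) ≡ suc m
      counts = count-jump-across Ka Jb cKJ cJK

    free-vertex⇒↔TJ : ∀ {K} → Independent G K → w ∉ K → (∀ y → y ∈ K → ¬ Adj G w y) →
                      count (K ∖ J) ≡ count (J ∖ K) → _↔TJ_ G K J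
    free-vertex⇒↔TJ {K} indK w∉K w≁K balanced with count (K ∖ J) in cKJ
    ... | zero = subst (_↔TJ_ G K) (count∖≡0⇒≡ cKJ (sym balanced)) (done indK)
    ... | suc m with count-witness {P = K ∖ J} (subst (0 <_) (sym cKJ) (s≤s z≤n))
    ... | a , Ka = step indK (jump-step (proj₁ (∖⁻ Ka)) w∉K)
      (free-token⇒↔TJ m (jump-independent indK λ y y∈K w~y → ⊥-elim (w≁K y y∈K w~y)) b∈jump
        (trans (proj₁ counts) cKJ) (trans (proj₂ counts) (sym balanced)))
      where
      counts : count (jump K a w ∖ J) ≡ count (K ∖ J) × count (J ∖ jump K a w) ≡ count (J ∖ K)
      counts = count-jump-outside Ka w∉K w∉J

  undominated : ∀ {I} → ¬ Dominating G I → ∃ λ w → w ∉ I × (∀ u → u ∈ I → ¬ Adj G w u)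
  undominated {I} ¬dom
    with ¬∀⟶∃¬ n _ (λ v → any? λ u → (u ∈? I) ×-dec ((u ≟ v) ⊎-dec (adj G v u ≟ᵇ true)))
               ¬dom
  ... | w , w-alone =
    w , (λ w∈I → w-alone (w , w∈I , inj₁ refl)) , λ u u∈I w~u → w-alone (u , u∈I , inj₂ w~u)

  across : ∀ {K L x y} → Independent G K → x ∈ K → (y ∈ K × y ∉ L) ⊎ (y ∈ L × y ∉ K) →
           Adj G x y → y ∈ L × y ∉ K
  across indK x∈K (inj₁ (y∈K , _)) x~y = ⊥-elim (indK _ _ x∈K y∈K x~y)
  across indK x∈K (inj₂ y∈L∖K)     _   = y∈L∖K

  module _ {I J : Subset n} (indI : Independent G I) (indJ : Independent G J)
           (cyc : EveryComponentCycle G (_Δ_ G I J)) where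

    ∈Δ⁻ : ∀ {x} → x ∈ _Δ_ G I J → (x ∈ I × x ∉ J) ⊎ (x ∈ J × x ∉ I)
    ∈Δ⁻ = map (x∈p─q⁻ I J) (x∈p─q⁻ J I) ∘ x∈p∪q⁻ (I ─ J) (J ─ I)

    ∈Δ⁺ : ∀ {x} → (x ∈ I × x ∉ J) ⊎ (x ∈ J × x ∉ I) → x ∈ _Δ_ G I J
    ∈Δ⁺ = x∈p∪q⁺ ∘ map (uncurry x∈p∧x∉q⇒x∈p─q) (uncurry x∈p∧x∉q⇒x∈p─q)

    2≤deg-across : ∀ {K L x} → Independent G K →
      (∀ {y} → y ∈ _Δ_ G I J → (y ∈ K × y ∉ L) ⊎ (y ∈ L × y ∉ K)) →
      x ∈ K → x ∈ _Δ_ G I J → 2 ≤ deg (L ∖ K) x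
    2≤deg-across {K} {L} {x} indK sides x∈K x∈S with cycle-neighbours cyc x∈S
    ... | y , z , y≢z , y∈S , z∈S , x~y , x~z = 2≤count (nbr y∈S x~y) (nbr z∈S x~z) y≢z
      where
      nbr : ∀ {y} → y ∈ _Δ_ G I J → Adj G x y → (L ∖ K) y ∧ adj G x y ≡ true
      nbr y∈S x~y = cong₂ _∧_ (uncurry ∖⁺ (across indK x∈K (sides y∈S) x~y)) x~y

    Δ-balanced : ClawFree G → count (I ∖ J) ≡ count (J ∖ I)
    Δ-balanced cf = ≤-antisym
      (claw-free-handshake cf indI (λ _ → proj₁ ∘ ∖⁻)
        λ x x∈ → 2≤deg-across indI ∈Δ⁻ (proj₁ (∖⁻ x∈)) (∈Δ⁺ (inj₁ (∖⁻ x∈))))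
      (claw-free-handshake cf indJ (λ _ → proj₁ ∘ ∖⁻)
        λ x x∈ → 2≤deg-across indJ (swap ∘ ∈Δ⁻) (proj₁ (∖⁻ x∈)) (∈Δ⁺ (inj₂ (∖⁻ x∈))))

    module _ {w : Fin n} (w∉I : w ∉ I) (w≁I : ∀ u → u ∈ I → ¬ Adj G w u) where

      undominated∉J : w ∉ J
      undominated∉J w∈J with cycle-neighbours cyc (∈Δ⁺ (inj₂ (w∈J , w∉I)))
      ... | y , _ , _ , y∈S , _ , w~y , _ =
        w≁I y (proj₁ (across indJ w∈J (swap (∈Δ⁻ y∈S)) w~y)) w~y

      undominated≁J : ClawFree G → ∀ x → x ∈ J → ¬ Adj G w x
      undominated≁J cf x x∈J w~x with x ∈? I
      ... | yes x∈I = w≁I x x∈I w~x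
      ... | no  x∉I with cycle-neighbours cyc (∈Δ⁺ (inj₂ (x∈J , x∉I)))
      ... | y , z , y≢z , y∈S , z∈S , x~y , x~z =
        cf x w y z (trans (adj-sym G x w) w~x , x~y , x~z , ≢I y∈I , ≢I z∈I , y≢z ,
                    w≁I y y∈I , w≁I z z∈I , indI y z y∈I z∈I)
        where
        y∈I : y ∈ I
        y∈I = proj₁ (across indJ x∈J (swap (∈Δ⁻ y∈S)) x~y)
        z∈I : z ∈ I
        z∈I = proj₁ (across indJ x∈J (swap (∈Δ⁻ z∈S)) x~z)
        ≢I : ∀ {u} → u ∈ I → w ≢ u
        ≢I u∈I refl = w∉I u∈I

proposition20 : {n : ℕ} (G : Graph n) (I J : Subset n) →
    ClawFree G → Independent G I → Independent G J →
    ¬ Dominating G I → EveryComponentCycle G (_Δ_ G I J) →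
    _↔TJ_ G I J
proposition20 G I J cf indI indJ ¬dom cyc with undominated G ¬dom
... | w , w∉I , w≁I =
  free-vertex⇒↔TJ G cf indJ w∉J w≁J indI w∉I w≁I (Δ-balanced G indI indJ cyc cf)
  where
  w∉J : w ∉ J
  w∉J = undominated∉J G indI indJ cyc w∉I w≁I
  w≁J : ∀ x → x ∈ J → ¬ Adj G w x
  w≁J = undominated≁J G indI indJ cyc w∉I w≁I cf
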